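{- Let $r,d$ be positive integers. For each $1\leq a<d$ the hypergraphs $\Omega_a^{(r,d)}$ and $\Omega_{a+1}^{(r,d)}$ are isomorphic, i.e. there is a bijection $\phi$ of $\{1,\dots,rd\}$ mapping the hyperedge set of $\Omega_{a+1}^{(r,d)}$ bijectively onto the hyperedge set of $\Omega_a^{(r,d)}$.
   Context: For $1\leq a\leq d$ let $S_a=\{ra-(r-1),ra-(r-2),\dots,ra\}$. Define $\Omega_a^{(r,d)}$ as the $r$-uniform hypergraph with vertex set $\{1,\dots,rd\}$ whose hyperedges are the sets $\{i_1,\dots,i_r\}$ with $1\leq i_1<\dots<i_r\leq rd$ such that for some $1\leq t\leq r$ one has $i_1+\dots+i_r\equiv t-1 \pmod r$ and $i_t\in S_a$. -}

module Defs where

open import Data.Nat using (ℕ; zero; suc; _+_; _*_; _∸_; _≤_; _<_; NonZero; _%_)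
open import Data.Fin using (Fin; toℕ)
open import Data.Fin.Subset using (Subset; _∈_)
open import Data.Bool using (Bool; true; false)
open import Data.List using (List; []; _∷_; length; map)
open import Data.Nat.ListAction using (sum)
open import Data.Maybe using (Maybe; just; nothing)
open import Data.Vec using (Vec; tabulate; lookup; _∷_)
open import Data.Product using (Σ; _×_; ∃)
open import Function.Bundles using (_↔_; Inverse)
open import Relation.Binary.PropositionalEquality using (_≡_)

-- Vertex i : Fin (r * d) represents the integer (toℕ i + 1) ∈ {1,…,rd}.

elems : ∀ {n} → Subset n → List ℕ
elems {zero} _ = []
elems {suc n} (false ∷ s) = map suc (elems s)
elems {suc n} (true ∷ s) = 0 ∷ map suc (elems s)

elems1 : ∀ {n} → Subset n → List ℕ
elems1 s = map suc (elems s)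

nth : List ℕ → ℕ → Maybe ℕ
nth [] _ = nothing
nth (x ∷ xs) zero = just x
nth (x ∷ xs) (suc t) = nth xs t

InS : (r a x : ℕ) → Set
InS r a x = (r * a < x + r) × (x ≤ r * a)

-- e is a hyperedge of Ω_a^{(r,d)}: e is an r-subset {i₁<…<iᵣ} of {1,…,rd}
-- and for some 1 ≤ t ≤ r, i₁+…+iᵣ ≡ t-1 (mod r) and i_t ∈ S_a.
-- Here t' = t - 1 ranges over 0 ≤ t' < r and i_t = nth (elems1 e) t'.
IsEdge : (r d : ℕ) .{{_ : NonZero r}} → (a : ℕ) → Subset (r * d) → Set
IsEdge r d a e =
  (length (elems1 e) ≡ r) ×
  Σ ℕ (λ t' → (t' < r) × (sum (elems1 e) % r ≡ t') ×
     Σ ℕ (λ x → (nth (elems1 e) t' ≡ just x) × InS r a x))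

image : ∀ {n} → (Fin n ↔ Fin n) → Subset n → Subset n
image φ e = tabulate (λ j → lookup e (Inverse.from φ j))

-- Cut {1,…,rd} into consecutive blocks P, S_a, S_{a+1}, Z. The bijection exchanges the two
-- middle blocks and, inside the block that moves up, rotates the vertices cyclically by one
-- place. Sort an r-set e and let p, k, l be its numbers of elements in P, S_a, S_{a+1}. Its
-- elements in S_{a+1} occupy the positions [p + k, p + k + l) of the sorted sequence, and
-- their images occupy the positions [p, p + l), now inside S_a. Translating whole blocks by
-- ±r does not change the element sum modulo r, while the rotation lowers it by k modulo r;
-- as p + k + l ≤ r there is no wrap-around, so the residue of the sum lies in the first
-- interval for e exactly when it lies in the second for the image of e.

module Submission where

open import Data.Bool using (Bool; true; false)
open import Data.Empty using (⊥-elim)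
open import Data.Fin using (Fin; zero; suc; inject₁; fromℕ)
open import Data.Fin.Properties using (+↔⊎)
open import Data.Fin.Relation.Unary.Top using (view; ‵fromℕ; ‵inj₁; view-fromℕ; view-inject₁)
open import Data.Fin.Subset using (Subset)
open import Data.List using (List; []; _∷_; length; map) renaming (_++_ to _++ₗ_)
open import Data.List.Properties using (map-++; map-∘; map-id; map-cong; length-++; length-map; ++-assoc)
open import Data.List.Relation.Unary.All as All using (All; []; _∷_)
open import Data.List.Relation.Unary.All.Properties using (map⁺; ++⁺)
open import Data.Maybe using (just)
open import Data.Nat
  using (ℕ; zero; suc; pred; _+_; _*_; _∸_; _%_; _≤_; _<_; z≤n; s≤s; s≤s⁻¹; z<s; NonZero)
open import Data.Nat.DivMod using ([m+kn]%n≡m%n; %-distribˡ-+; m<n⇒m%n≡m; m%n<n; m≤n⇒[n∸m]%m≡n%m)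
open import Data.Nat.ListAction using (sum)
open import Data.Nat.ListAction.Properties using (sum-++)
open import Data.Nat.Properties
open import Algebra.Properties.CommutativeSemigroup +-commutativeSemigroup
  using (x∙yz≈y∙xz; xy∙z≈xz∙y)
open import Data.Nat.Tactic.RingSolver using (solve-∀)
open import Data.Product using (∃; Σ; _×_; _,_; proj₁; proj₂)
import Data.Product as Product
open import Data.Sum using (_⊎_; inj₁; inj₂)
open import Data.Sum.Algebra using (⊎-assoc; ⊎-comm; ⊎-cong)
open import Data.Vec using (Vec; []; _∷_; _++_; _∷ʳ_; lookup; cast; splitAt)
open import Data.Vec.Properties
  using (lookup-++ˡ; lookup-++ʳ; tabulate-cong; tabulate∘lookup; unfold-∷ʳ-eqFree)
open import Function.Base using (_∘_)
open import Function.Bundles using (_↔_; _⇔_; Inverse; Equivalence; mk↔ₛ′; mk⇔)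
open import Function.Properties.Equivalence using () renaming (trans to ⇔-trans; sym to ⇔-sym)
open import Function.Properties.Inverse using (↔-refl; ↔-sym; ↔-trans)
open import Level using (0ℓ)
open import Relation.Binary.PropositionalEquality
open import Relation.Nullary using (¬_; yes; no; contradiction)

open import Defs

private
  variable
    A : Set
    k n : ℕ
    P Q : ℕ → Set
    xs ys zs : List ℕ

-- Rotating a block and exchanging two blocks

rotateˡ : Vec A (suc n) → Vec A (suc n)
rotateˡ (x ∷ xs) = xs ∷ʳ x

cyclicSuc : Fin (suc n) → Fin (suc n)
cyclicSuc i with view i
... | ‵fromℕ = zero
... | ‵inj₁ {i = k} _ = suc k

cyclicPred : Fin (suc n) → Fin (suc n)
cyclicPred zero = fromℕ _
cyclicPred (suc k) = inject₁ k

cyclicSuc-cyclicPred : (i : Fin (suc n)) → cyclicSuc (cyclicPred i) ≡ i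
cyclicSuc-cyclicPred {n} zero rewrite view-fromℕ n = refl
cyclicSuc-cyclicPred (suc k) rewrite view-inject₁ k = refl

cyclicPred-cyclicSuc : (i : Fin (suc n)) → cyclicPred (cyclicSuc i) ≡ i
cyclicPred-cyclicSuc i with view i
... | ‵fromℕ = refl
... | ‵inj₁ _ = refl

cyclicSuc↔ : Fin (suc n) ↔ Fin (suc n)
cyclicSuc↔ = mk↔ₛ′ cyclicSuc cyclicPred cyclicSuc-cyclicPred cyclicPred-cyclicSuc

lookup-∷ʳ-fromℕ : ∀ (x : A) (xs : Vec A n) → lookup (xs ∷ʳ x) (fromℕ n) ≡ x
lookup-∷ʳ-fromℕ x [] = refl
lookup-∷ʳ-fromℕ x (_ ∷ xs) = lookup-∷ʳ-fromℕ x xs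

lookup-∷ʳ-inject₁ : ∀ (x : A) (xs : Vec A n) i → lookup (xs ∷ʳ x) (inject₁ i) ≡ lookup xs i
lookup-∷ʳ-inject₁ x (_ ∷ xs) zero = refl
lookup-∷ʳ-inject₁ x (_ ∷ xs) (suc i) = lookup-∷ʳ-inject₁ x xs i

lookup-cyclicSuc : ∀ (v : Vec A (suc n)) i → lookup v (cyclicSuc i) ≡ lookup (rotateˡ v) i
lookup-cyclicSuc (x ∷ xs) i with view i
... | ‵fromℕ = sym (lookup-∷ʳ-fromℕ x xs)
... | ‵inj₁ {i = k} _ = sym (lookup-∷ʳ-inject₁ x xs k)

image-≡ : ∀ (φ : Fin n ↔ Fin n) (v w : Vec Bool n) →
          (∀ j → lookup v (Inverse.from φ j) ≡ lookup w j) → image φ v ≡ w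
image-≡ φ v w eq = trans (tabulate-cong eq) (tabulate∘lookup w)

exchange : {B C D : Set} → (B ⊎ (C ⊎ D)) ↔ (C ⊎ (B ⊎ D))
exchange {B} {C} {D} =
  ↔-trans (↔-sym (⊎-assoc 0ℓ B C D))
          (↔-trans (⊎-cong (⊎-comm B C) ↔-refl) (⊎-assoc 0ℓ C B D))

module BlockSwap (b r₀ m : ℕ) where

  R : ℕ
  R = suc r₀

  Blocks : Set
  Blocks = Fin b ⊎ (Fin R ⊎ (Fin R ⊎ Fin m))

  blocks : Fin (b + (R + (R + m))) ↔ Blocks
  blocks = ↔-trans +↔⊎ (⊎-cong ↔-refl (↔-trans +↔⊎ (⊎-cong ↔-refl +↔⊎)))

  swapBlocks : Blocks ↔ Blocks
  swapBlocks = ⊎-cong ↔-refl (↔-trans (⊎-cong (↔-sym cyclicSuc↔) ↔-refl) exchange)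

  blockSwap : Fin (b + (R + (R + m))) ↔ Fin (b + (R + (R + m)))
  blockSwap = ↔-trans blocks (↔-trans swapBlocks (↔-sym blocks))

  select : Vec A b → Vec A R → Vec A R → Vec A m → Blocks → A
  select P X Y Z (inj₁ i) = lookup P i
  select P X Y Z (inj₂ (inj₁ i)) = lookup X i
  select P X Y Z (inj₂ (inj₂ (inj₁ i))) = lookup Y i
  select P X Y Z (inj₂ (inj₂ (inj₂ i))) = lookup Z i

  lookup-blocks : ∀ (P : Vec A b) X Y (Z : Vec A m) s →
                  lookup (P ++ (X ++ (Y ++ Z))) (Inverse.from blocks s) ≡ select P X Y Z s
  lookup-blocks P X Y Z (inj₁ i) = lookup-++ˡ P _ i
  lookup-blocks P X Y Z (inj₂ (inj₁ i)) = trans (lookup-++ʳ P _ _) (lookup-++ˡ X _ i)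
  lookup-blocks P X Y Z (inj₂ (inj₂ (inj₁ i))) =
    trans (lookup-++ʳ P _ _) (trans (lookup-++ʳ X _ _) (lookup-++ˡ Y _ i))
  lookup-blocks P X Y Z (inj₂ (inj₂ (inj₂ i))) =
    trans (lookup-++ʳ P _ _) (trans (lookup-++ʳ X _ _) (lookup-++ʳ Y _ i))

  select-swapBlocks : ∀ (P : Vec A b) X Y (Z : Vec A m) s →
                      select P X Y Z (Inverse.from swapBlocks s) ≡ select P Y (rotateˡ X) Z s
  select-swapBlocks P X Y Z (inj₁ i) = refl
  select-swapBlocks P X Y Z (inj₂ (inj₁ i)) = refl
  select-swapBlocks P X Y Z (inj₂ (inj₂ (inj₁ i))) = lookup-cyclicSuc X i
  select-swapBlocks P X Y Z (inj₂ (inj₂ (inj₂ i))) = refl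

  image-blockSwap : ∀ (P : Vec Bool b) (X Y : Vec Bool R) (Z : Vec Bool m) →
                    image blockSwap (P ++ (X ++ (Y ++ Z))) ≡ P ++ (Y ++ (rotateˡ X ++ Z))
  image-blockSwap P X Y Z = image-≡ blockSwap before after pointwise
    where
    before = P ++ (X ++ (Y ++ Z))
    after = P ++ (Y ++ (rotateˡ X ++ Z))
    open ≡-Reasoning
    pointwise : ∀ j → lookup before (Inverse.from blockSwap j) ≡ lookup after j
    pointwise j = begin
      lookup before (Inverse.from blocks (Inverse.from swapBlocks s))
        ≡⟨ lookup-blocks P X Y Z (Inverse.from swapBlocks s) ⟩
      select P X Y Z (Inverse.from swapBlocks s)
        ≡⟨ select-swapBlocks P X Y Z s ⟩
      select P Y (rotateˡ X) Z s
        ≡⟨ lookup-blocks P Y (rotateˡ X) Z s ⟨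
      lookup after (Inverse.from blocks s)
        ≡⟨ cong (lookup after) (Inverse.strictlyInverseʳ blocks j) ⟩
      lookup after j ∎
      where s = Inverse.to blocks j

-- Intervals and residues

infix 4 _∈⟨_,_]
_∈⟨_,_] : ℕ → ℕ → ℕ → Set
x ∈⟨ l , u ] = l < x × x ≤ u

infix 4 _∈[_,_⟩
_∈[_,_⟩ : ℕ → ℕ → ℕ → Set
t ∈[ s , e ⟩ = s ≤ t × t < e

∈⟨]-disjoint : ∀ {x l u l′ u′} → u ≤ l′ ⊎ u′ ≤ l → x ∈⟨ l , u ] → ¬ x ∈⟨ l′ , u′ ]
∈⟨]-disjoint (inj₁ u≤l′) (_ , x≤u) (l′<x , _) = <⇒≱ l′<x (≤-trans x≤u u≤l′)
∈⟨]-disjoint (inj₂ u′≤l) (l<x , _) (_ , x≤u′) = <⇒≱ l<x (≤-trans x≤u′ u′≤l)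

module _ {n : ℕ} .{{_ : NonZero n}} where

  [m+k]%n≡[m%n+k]%n : ∀ m {k} → k < n → (m + k) % n ≡ (m % n + k) % n
  [m+k]%n≡[m%n+k]%n m {k} k<n =
    trans (%-distribˡ-+ m k n) (cong (λ i → (m % n + i) % n) (m<n⇒m%n≡m k<n))

  [m+k]%n≡m%n+k : ∀ m {k} → m % n + k < n → (m + k) % n ≡ m % n + k
  [m+k]%n≡m%n+k m {k} lt =
    trans ([m+k]%n≡[m%n+k]%n m (≤-<-trans (m≤n+m k (m % n)) lt)) (m<n⇒m%n≡m lt)

  [m+k]%n<k : ∀ m {k} → k < n → n ≤ m % n + k → (m + k) % n < k
  [m+k]%n<k m {k} k<n n≤ = begin-strict
    (m + k) % n          ≡⟨ [m+k]%n≡[m%n+k]%n m k<n ⟩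
    (m % n + k) % n      ≡⟨ m≤n⇒[n∸m]%m≡n%m n≤ ⟨
    (m % n + k ∸ n) % n  ≡⟨ m<n⇒m%n≡m (<-trans wrapped k<n) ⟩
    m % n + k ∸ n        <⟨ wrapped ⟩
    k                    ∎
    where
    open ≤-Reasoning
    wrapped : m % n + k ∸ n < k
    wrapped = subst (m % n + k ∸ n <_) (m+n∸m≡n n k) (∸-monoˡ-< (+-monoˡ-< k (m%n<n m n)) n≤)

  %-shift-∈ : ∀ {s k l x y} → s + k + l ≤ n → (y + k) % n ≡ x % n →
              x % n ∈[ s + k , s + k + l ⟩ ⇔ y % n ∈[ s , s + l ⟩
  %-shift-∈ {s} {k} {l} {x} {y} bound eq = mk⇔ to from
    where
    s+k+l≡s+l+k : s + k + l ≡ s + l + k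
    s+k+l≡s+l+k = xy∙z≈xz∙y s k l
    to : x % n ∈[ s + k , s + k + l ⟩ → y % n ∈[ s , s + l ⟩
    to (lo , hi) with y % n + k <? n
    ... | yes lt = +-cancelʳ-≤ k s (y % n) (subst (s + k ≤_) x%n≡ lo)
                 , +-cancelʳ-< k (y % n) (s + l) (subst₂ _<_ x%n≡ s+k+l≡s+l+k hi)
      where
      x%n≡ : x % n ≡ y % n + k
      x%n≡ = trans (sym eq) ([m+k]%n≡m%n+k y lt)
    ... | no ¬lt = contradiction (≤-trans (m≤n+m k s) lo)
                     (<⇒≱ (subst (_< k) eq ([m+k]%n<k y k<n (≮⇒≥ ¬lt))))
      where
      k<n : k < n
      k<n = ≤-<-trans (≤-trans (m≤n+m k s) lo) (m%n<n x n)
    from : y % n ∈[ s , s + l ⟩ → x % n ∈[ s + k , s + k + l ⟩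
    from (lo , hi) = subst (_∈[ s + k , s + k + l ⟩) x%n≡ (+-monoˡ-≤ k lo , y%n+k<s+k+l)
      where
      y%n+k<s+k+l : y % n + k < s + k + l
      y%n+k<s+k+l = subst (y % n + k <_) (sym s+k+l≡s+l+k) (+-monoˡ-< k hi)
      x%n≡ : y % n + k ≡ x % n
      x%n≡ = trans (sym ([m+k]%n≡m%n+k y (<-≤-trans y%n+k<s+k+l bound))) eq

-- Sorted element lists

shift : ℕ → List ℕ → List ℕ
shift c = map (c +_)

shift-shift : ∀ c d xs → shift c (shift d xs) ≡ shift (c + d) xs
shift-shift c d xs = trans (sym (map-∘ xs)) (map-cong (λ x → sym (+-assoc c d x)) xs)

sum-shift : ∀ c xs → sum (shift c xs) ≡ length xs * c + sum xs
sum-shift c [] = refl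
sum-shift c (x ∷ xs) = begin
  c + x + sum (shift c xs)        ≡⟨ cong (c + x +_) (sum-shift c xs) ⟩
  c + x + (length xs * c + sum xs) ≡⟨ rearrange c x (length xs) (sum xs) ⟩
  c + length xs * c + (x + sum xs) ∎
  where
  open ≡-Reasoning
  rearrange : ∀ c x l s → c + x + (l * c + s) ≡ c + l * c + (x + s)
  rearrange = solve-∀

length-++-shift : ∀ xs c ys → length (xs ++ₗ shift c ys) ≡ length xs + length ys
length-++-shift xs c ys = trans (length-++ xs) (cong (length xs +_) (length-map (c +_) ys))

sum-++-shift : ∀ xs c ys → sum (xs ++ₗ shift c ys) ≡ sum xs + (length ys * c + sum ys)
sum-++-shift xs c ys = trans (sum-++ xs _) (cong (sum xs +_) (sum-shift c ys))

length-blocks : ∀ xs i ys j zs ws →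
  length (xs ++ₗ (shift i ys ++ₗ (shift j zs ++ₗ ws))) ≡
  length xs + (length ys + (length zs + length ws))
length-blocks xs i ys j zs ws
  rewrite length-++ xs {shift i ys ++ₗ (shift j zs ++ₗ ws)} | length-++ (shift i ys) {shift j zs ++ₗ ws}
        | length-++ (shift j zs) {ws} | length-map (i +_) ys | length-map (j +_) zs = refl

sum-blocks : ∀ xs i ys j zs ws →
  sum (xs ++ₗ (shift i ys ++ₗ (shift j zs ++ₗ ws))) ≡
  sum xs + (length ys * i + sum ys + (length zs * j + sum zs + sum ws))
sum-blocks xs i ys j zs ws
  rewrite sum-++ xs (shift i ys ++ₗ (shift j zs ++ₗ ws)) | sum-++ (shift i ys) (shift j zs ++ₗ ws)
        | sum-++ (shift j zs) ws | sum-shift i ys | sum-shift j zs = refl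

sum-exchange : ∀ xs b R ys zs zs′ ws {c} →
  length zs′ ≡ length zs → sum zs′ + length zs ≡ sum zs + c * R →
  sum (xs ++ₗ (shift b ys ++ₗ (shift (b + R) zs′ ++ₗ ws))) + length zs + length ys * R ≡
  sum (xs ++ₗ (shift b zs ++ₗ (shift (b + R) ys ++ₗ ws))) + (length zs + c) * R
sum-exchange xs b R ys zs zs′ ws {c} same-length shifted-sum = begin
  sum (xs ++ₗ (shift b ys ++ₗ (shift (b + R) zs′ ++ₗ ws))) + ℓᶻ + ℓʸ * R
    ≡⟨ cong (λ σ → σ + ℓᶻ + ℓʸ * R) (sum-blocks xs b ys (b + R) zs′ ws) ⟩
  sum xs + (ℓʸ * b + sum ys + (length zs′ * (b + R) + sum zs′ + sum ws)) + ℓᶻ + ℓʸ * R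
    ≡⟨ cong (λ ℓ → sum xs + (ℓʸ * b + sum ys + (ℓ * (b + R) + sum zs′ + sum ws)) + ℓᶻ + ℓʸ * R)
            same-length ⟩
  sum xs + (ℓʸ * b + sum ys + (ℓᶻ * (b + R) + sum zs′ + sum ws)) + ℓᶻ + ℓʸ * R
    ≡⟨ regroup (sum xs) ℓʸ (sum ys) ℓᶻ (sum zs′) (sum ws) b R ⟩
  rest + (sum zs′ + ℓᶻ)
    ≡⟨ cong (rest +_) shifted-sum ⟩
  rest + (sum zs + c * R)
    ≡⟨ regroup′ (sum xs) ℓʸ (sum ys) ℓᶻ (sum zs) (sum ws) b R c ⟩
  sum xs + (ℓᶻ * b + sum zs + (ℓʸ * (b + R) + sum ys + sum ws)) + (ℓᶻ + c) * R
    ≡⟨ cong (_+ (ℓᶻ + c) * R) (sum-blocks xs b zs (b + R) ys ws) ⟨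
  sum (xs ++ₗ (shift b zs ++ₗ (shift (b + R) ys ++ₗ ws))) + (ℓᶻ + c) * R ∎
  where
  open ≡-Reasoning
  ℓʸ = length ys
  ℓᶻ = length zs
  rest = sum xs + (ℓʸ * b + sum ys) + ℓᶻ * (b + R) + sum ws + ℓʸ * R
  regroup : ∀ σˣ ℓʸ σʸ ℓᶻ σᶻ′ σʷ b R →
    σˣ + (ℓʸ * b + σʸ + (ℓᶻ * (b + R) + σᶻ′ + σʷ)) + ℓᶻ + ℓʸ * R ≡
    σˣ + (ℓʸ * b + σʸ) + ℓᶻ * (b + R) + σʷ + ℓʸ * R + (σᶻ′ + ℓᶻ)
  regroup = solve-∀
  regroup′ : ∀ σˣ ℓʸ σʸ ℓᶻ σᶻ σʷ b R c →
    σˣ + (ℓʸ * b + σʸ) + ℓᶻ * (b + R) + σʷ + ℓʸ * R + (σᶻ + c * R) ≡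
    σˣ + (ℓᶻ * b + σᶻ + (ℓʸ * (b + R) + σʸ + σʷ)) + (ℓᶻ + c) * R
  regroup′ = solve-∀

suc-∈⟨0,] : ∀ {x} → x ∈⟨ 0 , n ] → suc x ∈⟨ 0 , suc n ]
suc-∈⟨0,] (_ , x≤n) = z<s , s≤s x≤n

shift-∈⟨] : ∀ c {xs} → All (_∈⟨ 0 , n ]) xs → All (_∈⟨ c , c + n ]) (shift c xs)
shift-∈⟨] c bounds = map⁺ (All.map (λ (0<x , x≤n) → m<m+n c 0<x , +-monoʳ-≤ c x≤n) bounds)

elems1-++ : ∀ (u : Vec Bool k) (w : Vec Bool n) → elems1 (u ++ w) ≡ elems1 u ++ₗ shift k (elems1 w)
map-suc-elems1-++ : ∀ (u : Vec Bool k) (w : Vec Bool n) →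
                    map suc (elems1 (u ++ w)) ≡ map suc (elems1 u) ++ₗ shift (suc k) (elems1 w)

elems1-++ [] w = sym (map-id (elems1 w))
elems1-++ (false ∷ u) w = map-suc-elems1-++ u w
elems1-++ (true ∷ u) w = cong (1 ∷_) (map-suc-elems1-++ u w)

map-suc-elems1-++ u w = begin
  map suc (elems1 (u ++ w))
    ≡⟨ cong (map suc) (elems1-++ u w) ⟩
  map suc (elems1 u ++ₗ shift _ (elems1 w))
    ≡⟨ map-++ suc (elems1 u) _ ⟩
  map suc (elems1 u) ++ₗ map suc (shift _ (elems1 w))
    ≡⟨ cong (map suc (elems1 u) ++ₗ_) (map-∘ (elems1 w)) ⟨
  map suc (elems1 u) ++ₗ shift (suc _) (elems1 w) ∎
  where open ≡-Reasoning

elems1-cast : ∀ .(eq : k ≡ n) (v : Vec Bool k) → elems1 (cast eq v) ≡ elems1 v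
elems1-cast {n = zero} eq [] = refl
elems1-cast {n = suc _} eq (false ∷ v) = cong (map suc) (elems1-cast (cong pred eq) v)
elems1-cast {n = suc _} eq (true ∷ v) = cong (λ L → 1 ∷ map suc L) (elems1-cast (cong pred eq) v)

elems1-∷ʳ : ∀ (u : Vec Bool n) x → elems1 (u ∷ʳ x) ≡ elems1 u ++ₗ shift n (elems1 (x ∷ []))
elems1-∷ʳ u x = begin
  elems1 (u ∷ʳ x)                         ≡⟨ elems1-cast (+-comm 1 _) (u ∷ʳ x) ⟨
  elems1 (cast (+-comm 1 _) (u ∷ʳ x))     ≡⟨ cong elems1 (unfold-∷ʳ-eqFree x u) ⟩
  elems1 (u ++ x ∷ [])                    ≡⟨ elems1-++ u (x ∷ []) ⟩
  elems1 u ++ₗ shift _ (elems1 (x ∷ [])) ∎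
  where open ≡-Reasoning

elems1-++₄ : ∀ {i j l} (u : Vec Bool i) (v : Vec Bool j) (w : Vec Bool k) (z : Vec Bool l) →
  elems1 (u ++ (v ++ (w ++ z))) ≡
  elems1 u ++ₗ (shift i (elems1 v) ++ₗ (shift (i + j) (elems1 w) ++ₗ shift (i + (j + k)) (elems1 z)))
elems1-++₄ {k = k} {i = i} {j = j} u v w z = begin
  elems1 (u ++ (v ++ (w ++ z)))
    ≡⟨ elems1-++ u _ ⟩
  elems1 u ++ₗ shift i (elems1 (v ++ (w ++ z)))
    ≡⟨ cong (λ L → elems1 u ++ₗ shift i L) (elems1-++ v _) ⟩
  elems1 u ++ₗ shift i (elems1 v ++ₗ shift j (elems1 (w ++ z)))
    ≡⟨ cong (λ L → elems1 u ++ₗ shift i (elems1 v ++ₗ shift j L)) (elems1-++ w z) ⟩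
  elems1 u ++ₗ shift i (elems1 v ++ₗ shift j (elems1 w ++ₗ shift k (elems1 z)))
    ≡⟨ cong (elems1 u ++ₗ_) (shift-++₃ (elems1 v) (elems1 w) (elems1 z)) ⟩
  elems1 u ++ₗ (shift i (elems1 v) ++ₗ (shift (i + j) (elems1 w) ++ₗ shift (i + (j + k)) (elems1 z))) ∎
  where
  open ≡-Reasoning
  shift-++₃ : ∀ xs ys zs → shift i (xs ++ₗ shift j (ys ++ₗ shift k zs)) ≡
                           shift i xs ++ₗ (shift (i + j) ys ++ₗ shift (i + (j + k)) zs)
  shift-++₃ xs ys zs
    rewrite map-++ (i +_) xs (shift j (ys ++ₗ shift k zs)) | shift-shift i j (ys ++ₗ shift k zs)
          | map-++ ((i + j) +_) ys (shift k zs) | shift-shift (i + j) k zs | +-assoc i j k = refl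

elems1-∈⟨] : ∀ (u : Vec Bool n) → All (_∈⟨ 0 , n ]) (elems1 u)
elems1-∈⟨] [] = []
elems1-∈⟨] (false ∷ u) = map⁺ (All.map suc-∈⟨0,] (elems1-∈⟨] u))
elems1-∈⟨] (true ∷ u) = (z<s , s≤s z≤n) ∷ map⁺ (All.map suc-∈⟨0,] (elems1-∈⟨] u))

length-elems1-rotateˡ : ∀ (v : Vec Bool (suc n)) → length (elems1 (rotateˡ v)) ≡ length (elems1 v)
length-elems1-rotateˡ (x ∷ xs) = begin
  length (elems1 (xs ∷ʳ x))                  ≡⟨ cong length (elems1-∷ʳ xs x) ⟩
  length (elems1 xs ++ₗ shift _ (elems1 (x ∷ []))) ≡⟨ length-++-shift (elems1 xs) _ _ ⟩
  length (elems1 xs) + length (elems1 (x ∷ []))     ≡⟨ +-comm (length (elems1 xs)) _ ⟩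
  length (elems1 (x ∷ [])) + length (elems1 xs)     ≡⟨ length-++-shift (elems1 (x ∷ [])) 1 _ ⟨
  length (elems1 (x ∷ []) ++ₗ shift 1 (elems1 xs)) ≡⟨ cong length (elems1-++ (x ∷ []) xs) ⟨
  length (elems1 (x ∷ xs)) ∎
  where open ≡-Reasoning

sum-elems1-rotateˡ : ∀ (v : Vec Bool (suc n)) →
  ∃ λ c → sum (elems1 (rotateˡ v)) + length (elems1 v) ≡ sum (elems1 v) + c * suc n
sum-elems1-rotateˡ {n} (x ∷ xs) = length s , (begin
  sum (elems1 (xs ∷ʳ x)) + length (elems1 (x ∷ xs))
    ≡⟨ cong₂ (λ L L′ → sum L + length L′) (elems1-∷ʳ xs x) (elems1-++ (x ∷ []) xs) ⟩
  sum (E ++ₗ shift n s) + length (s ++ₗ shift 1 E)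
    ≡⟨ cong₂ _+_ (sum-++-shift E n s) (length-++-shift s 1 E) ⟩
  sum E + (length s * n + sum s) + (length s + length E)
    ≡⟨ rearrange (sum E) (length s) (sum s) (length E) n ⟩
  sum s + (length E * 1 + sum E) + length s * suc n
    ≡⟨ cong (_+ length s * suc n) (sum-++-shift s 1 E) ⟨
  sum (s ++ₗ shift 1 E) + length s * suc n
    ≡⟨ cong (λ L → sum L + length s * suc n) (elems1-++ (x ∷ []) xs) ⟨
  sum (elems1 (x ∷ xs)) + length s * suc n ∎)
  where
  E = elems1 xs
  s = elems1 (x ∷ [])
  open ≡-Reasoning
  rearrange : ∀ σE ℓs σs ℓE n →
    σE + (ℓs * n + σs) + (ℓs + ℓE) ≡ σs + (ℓE * 1 + σE) + ℓs * suc n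
  rearrange = solve-∀

-- Positions of the elements of a block

HitAt : (ℕ → Set) → List ℕ → ℕ → Set
HitAt Q L t = ∃ λ x → nth L t ≡ just x × Q x

HitsExactly : (ℕ → Set) → List ℕ → ℕ → ℕ → Set
HitsExactly Q L s e = ∀ t → HitAt Q L t ⇔ t ∈[ s , e ⟩

All-nth : ∀ {t x} → All P xs → nth xs t ≡ just x → P x
All-nth {t = zero} (p ∷ _) refl = p
All-nth {t = suc t} (_ ∷ ps) eq = All-nth ps eq

hits-prefix : All Q ys → All (¬_ ∘ Q) zs → ∀ t → HitAt Q (ys ++ₗ zs) t ⇔ t < length ys
hits-prefix [] ¬qs t = mk⇔ (λ (_ , eq , q) → ⊥-elim (All-nth ¬qs eq q)) λ ()
hits-prefix (q ∷ _) _ zero = mk⇔ (λ _ → z<s) (λ _ → _ , refl , q)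
hits-prefix (_ ∷ qs) ¬qs (suc t) = ⇔-trans (hits-prefix qs ¬qs t) (mk⇔ s≤s s≤s⁻¹)

hits-middle : All (¬_ ∘ Q) xs → All Q ys → All (¬_ ∘ Q) zs →
              HitsExactly Q (xs ++ₗ ys ++ₗ zs) (length xs) (length xs + length ys)
hits-middle [] qs ¬qs t = ⇔-trans (hits-prefix qs ¬qs t) (mk⇔ (z≤n ,_) proj₂)
hits-middle (¬q ∷ _) _ _ zero = mk⇔ (λ { (_ , refl , q) → ⊥-elim (¬q q) }) λ { (() , _) }
hits-middle (_ ∷ ¬qs) qs ¬qs′ (suc t) =
  ⇔-trans (hits-middle ¬qs qs ¬qs′ t) (mk⇔ (Product.map s≤s s≤s) (Product.map s≤s⁻¹ s≤s⁻¹))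

-- IsEdge r d a e is IsEdgeList r (InS r a) (elems1 e) by definition.
IsEdgeList : (r : ℕ) .{{_ : NonZero r}} → (ℕ → Set) → List ℕ → Set
IsEdgeList r Q L = (length L ≡ r) × Σ ℕ (λ t → (t < r) × (sum L % r ≡ t) × HitAt Q L t)

EdgeIsomorphism : (n r : ℕ) .{{_ : NonZero r}} → (ℕ → Set) → (ℕ → Set) → Set
EdgeIsomorphism n r Q Q′ = Σ (Fin n ↔ Fin n) λ φ →
  (e : Subset n) → IsEdgeList r Q (elems1 e) ⇔ IsEdgeList r Q′ (elems1 (image φ e))

isEdgeList⇔ : ∀ {r} .{{_ : NonZero r}} {L s e} → HitsExactly Q L s e →
              IsEdgeList r Q L ⇔ (length L ≡ r × sum L % r ∈[ s , e ⟩)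
isEdgeList⇔ {r = r} {L} hits = mk⇔
  (λ { (len , t , _ , refl , hit) → len , Equivalence.to (hits t) hit })
  (λ (len , t∈) → len , sum L % r , m%n<n (sum L) r , refl , Equivalence.from (hits _) t∈)

isEdgeList-shift : ∀ {r} .{{_ : NonZero r}} {Q′ L L′ s k l} →
  HitsExactly Q L (s + k) (s + k + l) → HitsExactly Q′ L′ s (s + l) →
  length L′ ≡ length L → s + k + l ≤ length L → (sum L′ + k) % r ≡ sum L % r →
  IsEdgeList r Q L ⇔ IsEdgeList r Q′ L′
isEdgeList-shift {r = r} {L = L} {L′} {s} {k} {l} hits hits′ len bound sums =
  ⇔-trans (isEdgeList⇔ {L = L} hits) (⇔-trans residues (⇔-sym (isEdgeList⇔ {L = L′} hits′)))
  where
  shifted : length L ≡ r → sum L % r ∈[ s + k , s + k + l ⟩ ⇔ sum L′ % r ∈[ s , s + l ⟩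
  shifted ℓ = %-shift-∈ (subst (s + k + l ≤_) ℓ bound) sums
  residues : (length L ≡ r × sum L % r ∈[ s + k , s + k + l ⟩) ⇔
             (length L′ ≡ r × sum L′ % r ∈[ s , s + l ⟩)
  residues = mk⇔ (λ (ℓ , x∈) → trans len ℓ , Equivalence.to (shifted ℓ) x∈)
                 (λ (ℓ′ , y∈) → let ℓ = trans (sym len) ℓ′ in
                                 ℓ , Equivalence.from (shifted ℓ) y∈)

-- The blocks S_a

InS-suc⇔ : ∀ r a {x} → InS r (suc a) x ⇔ x ∈⟨ r * a , r * a + r ]
InS-suc⇔ r a {x} rewrite *-suc r a | +-comm r (r * a) =
  mk⇔ (Product.map₁ (+-cancelʳ-< r (r * a) x)) (Product.map₁ (+-monoˡ-< r))

All-∈⟨] : ∀ {l u} → (∀ {x} → Q x ⇔ x ∈⟨ l , u ]) → All (_∈⟨ l , u ]) xs → All Q xs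
All-∈⟨] Q⇔ = All.map (Equivalence.from Q⇔)

All-∉⟨] : ∀ {l u l′ u′} → (∀ {x} → Q x ⇔ x ∈⟨ l′ , u′ ]) → u ≤ l′ ⊎ u′ ≤ l →
          All (_∈⟨ l , u ]) xs → All (¬_ ∘ Q) xs
All-∉⟨] Q⇔ apart = All.map (λ x∈ → ∈⟨]-disjoint apart x∈ ∘ Equivalence.to Q⇔)

module Transposition (r₀ a₀ m : ℕ) where

  R b : ℕ
  R = suc r₀
  b = R * a₀

  open BlockSwap b r₀ m using (blockSwap; image-blockSwap)

  Sₐ Sₐ₊₁ : ℕ → Set
  Sₐ = InS R (suc a₀)
  Sₐ₊₁ = InS R (suc (suc a₀))

  Sₐ⇔ : ∀ {x} → Sₐ x ⇔ x ∈⟨ b , b + R ]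
  Sₐ⇔ = InS-suc⇔ R a₀

  Sₐ₊₁⇔ : ∀ {x} → Sₐ₊₁ x ⇔ x ∈⟨ b + R , b + R + R ]
  Sₐ₊₁⇔ {x} = subst (λ c → Sₐ₊₁ x ⇔ x ∈⟨ c , c + R ])
                     (trans (*-suc R a₀) (+-comm R b)) (InS-suc⇔ R (suc a₀))

  module _ (P : Vec Bool b) (X Y : Vec Bool R) (Z : Vec Bool m) where

    Lᴾ Lˣ Lʸ Lˣ′ Lᶻ : List ℕ
    Lᴾ = elems1 P
    Lˣ = elems1 X
    Lʸ = elems1 Y
    Lˣ′ = elems1 (rotateˡ X)
    Lᶻ = shift (b + (R + R)) (elems1 Z)

    before after : List ℕ
    before = Lᴾ ++ₗ (shift b Lˣ ++ₗ (shift (b + R) Lʸ ++ₗ Lᶻ))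
    after = Lᴾ ++ₗ (shift b Lʸ ++ₗ (shift (b + R) Lˣ′ ++ₗ Lᶻ))

    p kˣ kʸ : ℕ
    p = length Lᴾ
    kˣ = length Lˣ
    kʸ = length Lʸ

    hits-before : HitsExactly Sₐ₊₁ before (p + kˣ) (p + kˣ + kʸ)
    hits-before = subst (λ L → HitsExactly Sₐ₊₁ L (p + kˣ) (p + kˣ + kʸ)) (++-assoc Lᴾ (shift b Lˣ) _)
      (subst₂ (HitsExactly Sₐ₊₁ ((Lᴾ ++ₗ shift b Lˣ) ++ₗ (shift (b + R) Lʸ ++ₗ Lᶻ)))
        front (cong₂ _+_ front (length-map _ Lʸ)) (hits-middle below inside above))
      where
      front : length (Lᴾ ++ₗ shift b Lˣ) ≡ p + kˣ
      front = length-++-shift Lᴾ b Lˣ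
      below : All (¬_ ∘ Sₐ₊₁) (Lᴾ ++ₗ shift b Lˣ)
      below = ++⁺ (All-∉⟨] Sₐ₊₁⇔ (inj₁ (m≤m+n b R)) (elems1-∈⟨] P))
                  (All-∉⟨] Sₐ₊₁⇔ (inj₁ ≤-refl) (shift-∈⟨] b (elems1-∈⟨] X)))
      inside : All Sₐ₊₁ (shift (b + R) Lʸ)
      inside = All-∈⟨] Sₐ₊₁⇔ (shift-∈⟨] (b + R) (elems1-∈⟨] Y))
      above : All (¬_ ∘ Sₐ₊₁) Lᶻ
      above = All-∉⟨] Sₐ₊₁⇔ (inj₂ (≤-reflexive (+-assoc b R R))) (shift-∈⟨] (b + (R + R)) (elems1-∈⟨] Z))

    hits-after : HitsExactly Sₐ after p (p + kʸ)
    hits-after = subst (HitsExactly Sₐ after p) (cong (p +_) (length-map _ Lʸ)) (hits-middle below inside above)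
      where
      below : All (¬_ ∘ Sₐ) Lᴾ
      below = All-∉⟨] Sₐ⇔ (inj₁ ≤-refl) (elems1-∈⟨] P)
      inside : All Sₐ (shift b Lʸ)
      inside = All-∈⟨] Sₐ⇔ (shift-∈⟨] b (elems1-∈⟨] Y))
      above : All (¬_ ∘ Sₐ) (shift (b + R) Lˣ′ ++ₗ Lᶻ)
      above = ++⁺ (All-∉⟨] Sₐ⇔ (inj₂ ≤-refl) (shift-∈⟨] (b + R) (elems1-∈⟨] (rotateˡ X))))
                  (All-∉⟨] Sₐ⇔ (inj₂ (+-monoʳ-≤ b (m≤m+n R R))) (shift-∈⟨] (b + (R + R)) (elems1-∈⟨] Z)))

    length-after : length after ≡ length before
    length-after = begin
      length after                        ≡⟨ length-blocks Lᴾ b Lʸ (b + R) Lˣ′ Lᶻ ⟩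
      p + (kʸ + (length Lˣ′ + length Lᶻ)) ≡⟨ cong (λ k → p + (kʸ + (k + length Lᶻ)))
                                                   (length-elems1-rotateˡ X) ⟩
      p + (kʸ + (kˣ + length Lᶻ))         ≡⟨ cong (p +_) (x∙yz≈y∙xz kʸ kˣ (length Lᶻ)) ⟩
      p + (kˣ + (kʸ + length Lᶻ))         ≡⟨ length-blocks Lᴾ b Lˣ (b + R) Lʸ Lᶻ ⟨
      length before                       ∎
      where open ≡-Reasoning

    bound : p + kˣ + kʸ ≤ length before
    bound = begin
      p + kˣ + kʸ                  ≤⟨ m≤m+n (p + kˣ + kʸ) (length Lᶻ) ⟩
      p + kˣ + kʸ + length Lᶻ      ≡⟨ trans (+-assoc (p + kˣ) kʸ _) (+-assoc p kˣ _) ⟩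
      p + (kˣ + (kʸ + length Lᶻ))  ≡⟨ length-blocks Lᴾ b Lˣ (b + R) Lʸ Lᶻ ⟨
      length before                ∎
      where open ≤-Reasoning

    sum-after : (sum after + kˣ) % R ≡ sum before % R
    sum-after = begin
      (sum after + kˣ) % R             ≡⟨ [m+kn]%n≡m%n (sum after + kˣ) kʸ R ⟨
      (sum after + kˣ + kʸ * R) % R    ≡⟨ cong (_% R) exchanged ⟩
      (sum before + (kˣ + c) * R) % R  ≡⟨ [m+kn]%n≡m%n (sum before) (kˣ + c) R ⟩
      sum before % R                   ∎
      where
      open ≡-Reasoning
      c = proj₁ (sum-elems1-rotateˡ X)
      exchanged : sum after + kˣ + kʸ * R ≡ sum before + (kˣ + c) * R
      exchanged = sum-exchange Lᴾ b R Lʸ Lˣ Lˣ′ Lᶻ (length-elems1-rotateˡ X) (proj₂ (sum-elems1-rotateˡ X))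

    edges : IsEdgeList R Sₐ₊₁ before ⇔ IsEdgeList R Sₐ after
    edges = isEdgeList-shift {L = before} {after} hits-before hits-after length-after bound sum-after

  transposition : EdgeIsomorphism (b + (R + (R + m))) R Sₐ₊₁ Sₐ
  transposition = blockSwap , edges-of
    where
    edges-of : (e : Subset (b + (R + (R + m)))) →
               IsEdgeList R Sₐ₊₁ (elems1 e) ⇔ IsEdgeList R Sₐ (elems1 (image blockSwap e))
    edges-of e with splitAt b e
    ... | P , W , refl with splitAt R W
    ... | X , W′ , refl with splitAt R W′
    ... | Y , Z , refl =
      subst₂ (λ L L′ → IsEdgeList R Sₐ₊₁ L ⇔ IsEdgeList R Sₐ L′)
        (sym (elems1-++₄ P X Y Z))
        (sym (trans (cong elems1 (image-blockSwap P X Y Z)) (elems1-++₄ P Y (rotateˡ X) Z)))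
        (edges P X Y Z)

lemma3p3 : (r d : ℕ) .{{_ : NonZero r}} → (a : ℕ) → 1 ≤ a → a < d →
    Σ (Fin (r * d) ↔ Fin (r * d))
      (λ φ → (e : Subset (r * d)) → IsEdge r d (suc a) e ⇔ IsEdge r d a (image φ e))
lemma3p3 (suc r₀) _ (suc a₀) _ a<d with m≤n⇒∃[o]m+o≡n a<d
... | o , refl =
  subst (λ n → EdgeIsomorphism n R (InS R (suc (suc a₀))) (InS R (suc a₀)))
    (sym (vertices r₀ a₀ o))
    (Transposition.transposition r₀ a₀ (R * o))
  where
  R = suc r₀
  vertices : ∀ r₀ a₀ o →
    suc r₀ * (2 + a₀ + o) ≡ suc r₀ * a₀ + (suc r₀ + (suc r₀ + suc r₀ * o))
  vertices = solve-∀
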